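{- Let $\alpha=(\alpha_1,\dots,\alpha_m)$ be a strong composition of $n\ge1$ and $\delta=(\delta_1,\dots,\delta_m)$ a weak composition with $\delta_1=0$. For every $w\in\mathcal{W}_{\alpha,\delta}$, $\#[w]=\frac{n}{\alpha_1}\cdot\#([w]\cap\widetilde{\mathcal{W}}_{\alpha,\delta})$, where $[w]$ is the necklace of $w$. Consequently $\#\mathcal{W}_{\alpha,\delta}=\frac{n}{\alpha_1}\cdot\#\widetilde{\mathcal{W}}_{\alpha,\delta}$.
   Context: A word of length $n$ is a sequence of positive integers; its content is the sequence whose $j$-th entry is the number of $j$'s. $\mathrm{cdes}(w)=\#\{1\le i\le n:w_i>w_{i+1}\}$ with indices mod $n$ (empty word: 0). $w^{(i)}$ is the subsequence of letters $\le i$. For $w$ of content $\alpha$ with $m$ parts, $\mathrm{CDT}(w)=(\mathrm{cdes}(w^{(1)}),\mathrm{cdes}(w^{(2)})-\mathrm{cdes}(w^{(1)}),\dots,\mathrm{cdes}(w^{(m)})-\mathrm{cdes}(w^{(m-1)}))$. $\mathcal{W}_{\alpha,\delta}$ is the set of words with content $\alpha$ and $\mathrm{CDT}=\delta$, and $\widetilde{\mathcal{W}}_{\alpha,\delta}$ is the subset of those whose last letter is $1$. The necklace $[w]$ is the orbit of $w$ under rotation $w_1\cdots w_n\mapsto w_nw_1\cdots w_{n-1}$. -}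

module Defs where

open import Data.Nat using (ℕ; zero; suc; _+_; _*_; _∸_; _≤_; _<_; _≤?_; _<?_; _≟_)
open import Data.Nat.Properties as ℕP using ()
open import Data.Integer as ℤ using (ℤ; +_)
open import Data.Integer.Properties as ℤP using ()
open import Data.List using (List; []; _∷_; _++_; length; filter; map; reverse; zip; concatMap; upTo; deduplicate; last)
open import Data.List.Properties using (≡-dec)
open import Data.List.Relation.Unary.All using (All; all?)
open import Data.Maybe using (Maybe; just; nothing)
open import Data.Product using (_×_; _,_)
open import Data.Nat.ListAction using (sum)
open import Relation.Nullary using (Dec; yes; no)
open import Relation.Nullary.Decidable using (_×-dec_)
open import Relation.Binary.PropositionalEquality using (_≡_)

-- A word is a finite sequence of natural numbers; positivity of letters
-- is imposed separately (see `Positive`).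
Word : Set
Word = List ℕ

Positive : Word → Set
Positive w = All (1 ≤_) w

count : ℕ → Word → ℕ
count j w = length (filter (j ≟_) w)

maxLetter : Word → ℕ
maxLetter [] = 0
maxLetter (x ∷ xs) = Data.Nat._⊔_ x (maxLetter xs)

oneTo : ℕ → List ℕ
oneTo k = map suc (upTo k)

content : Word → List ℕ
content w = map (λ j → count j w) (oneTo (maxLetter w))

shiftL : Word → Word
shiftL [] = []
shiftL (x ∷ xs) = xs ++ (x ∷ [])

-- cyclic descents: #{ i : wᵢ > wᵢ₊₁ }, indices mod n; 0 for the empty word
cdes : Word → ℕ
cdes w = length (filter (λ p → Data.Product.proj₂ p <? Data.Product.proj₁ p) (zip w (shiftL w)))

restrict : ℕ → Word → Word
restrict i w = filter (_≤? i) w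

-- cdes(w^(j)) - cdes(w^(j-1)) as an integer (w^(0) is empty, cdes 0)
cdesDiff : Word → ℕ → ℤ
cdesDiff w zero = + 0
cdesDiff w (suc j) = (+ cdes (restrict (suc j) w)) ℤ.- (+ cdes (restrict j w))

CDT : ℕ → Word → List ℤ
CDT m w = map (cdesDiff w) (oneTo m)

InW : List ℕ → List ℕ → Word → Set
InW α δ w = Positive w × (content w ≡ α) × (CDT (length α) w ≡ map +_ δ)

InW~ : List ℕ → List ℕ → Word → Set
InW~ α δ w = InW α δ w × (last w ≡ just 1)

inW? : (α δ : List ℕ) (w : Word) → Dec (InW α δ w)
inW? α δ w =
  all? (1 ≤?_) w ×-dec (≡-dec _≟_ (content w) α ×-dec ≡-dec ℤ._≟_ (CDT (length α) w) (map +_ δ))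

inW~? : (α δ : List ℕ) (w : Word) → Dec (InW~ α δ w)
inW~? α δ w = inW? α δ w ×-dec Data.Maybe.Properties.≡-dec _≟_ (last w) (just 1)
  where import Data.Maybe.Properties

-- rotation w₁ ⋯ wₙ ↦ wₙ w₁ ⋯ wₙ₋₁
rotRev : List ℕ → Word
rotRev [] = []
rotRev (x ∷ r) = x ∷ reverse r

rot : Word → Word
rot w = rotRev (reverse w)

rotN : ℕ → Word → Word
rotN zero w = w
rotN (suc k) w = rot (rotN k w)

-- the necklace [w], as the duplicate-free list of all rotations of w
-- (rotation has order dividing n = length w, so k < n covers the orbit)
necklace : Word → List Word
necklace w = deduplicate (≡-dec _≟_) (map (λ k → rotN k w) (upTo (length w)))

wordsOver : ℕ → ℕ → List Word
wordsOver zero m = [] ∷ []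
wordsOver (suc k) m = concatMap (λ a → map (a ∷_) (wordsOver k m)) (oneTo m)

-- #𝒲_{α,δ} : every word of content α (with m = length α parts, sum α = n)
-- has length n and letters in {1..m}, so we count inside that finite universe
cardW : List ℕ → List ℕ → ℕ
cardW α δ = length (filter (inW? α δ) (wordsOver (sum α) (length α)))

cardW~ : List ℕ → List ℕ → ℕ
cardW~ α δ = length (filter (inW~? α δ) (wordsOver (sum α) (length α)))

module Submission where

-- Lemma 5.15 is a double count. Let S be a duplicate-free list of words that is closed under
-- the rotation rot (last letter to the front), with every word of length n. The last letters
-- of u, rot u, …, rot^(n-1) u are the letters of u read backwards, so counting the pairs
-- (u , k), k < n, with rot^k u ending in j gives
--     Σ_{u ∈ S} #j(u) = Σ_{k < n} #{u ∈ S : rot^k u ends with j} = n · #{u ∈ S : u ends with j},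
-- since rot permutes S (cyclic-count). For S ⊆ 𝒲_{α,δ} every word has α₁ ones and length n,
-- and a word of 𝒲_{α,δ} lies in 𝒲̃_{α,δ} iff it ends with 1 (rotation-closed-count).

open import Defs
open import Data.Nat using (ℕ; zero; suc; _+_; _*_; _≤_; _<_; _≟_; _≤?_; _<?_; _⊔_; s≤s; z≤n)
open import Data.Nat.Properties
  using ( +-comm; *-zeroʳ; *-identityʳ; *-comm; suc-injective; ≤-trans; ≤-antisym; ≮⇒≥
        ; m≤m⊔n; m≤n⊔m; ⊔-0-commutativeMonoid; +-commutativeSemigroup)
open import Algebra.Bundles using (CommutativeMonoid)
open import Algebra.Properties.CommutativeSemigroup +-commutativeSemigroup using (interchange)
open import Data.Nat.ListAction using (sum)
open import Data.Nat.ListAction.Properties using (sum-↭)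
import Data.Integer as ℤ
open import Data.Bool using (true; false; if_then_else_)
open import Data.List
  using ( List; []; _∷_; _++_; _∷ʳ_; [_]; length; filter; map; foldr; reverse; zip; upTo; applyUpTo
        ; last; initLast; _∷ʳ′_; concatMap; cartesianProductWith)
open import Data.List.Properties
  using ( ≡-dec; ∷-injective; ∷-injectiveˡ; ++-assoc; ++-identityʳ; length-++; length-upTo
        ; reverse-++; reverse-involutive; reverse-injective; map-∘; map-cong; map-cong-local; map-upTo
        ; filter-++; filter-accept; filter-reject; filter-none)
open import Data.List.Reverse using (Reverse; reverseView; []; _∶_∶ʳ_)
open import Data.List.Relation.Unary.All as All using (All; []; _∷_)
open import Data.List.Relation.Unary.Any using (here; there)
open import Data.List.Relation.Unary.AllPairs using ([]; _∷_)
open import Data.List.Relation.Unary.Unique.Propositional using (Unique)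
import Data.List.Relation.Unary.Unique.Propositional.Properties as Unique
import Data.List.Relation.Unary.Unique.DecPropositional.Properties as DecUnique
open import Data.List.Membership.Propositional using (_∈_)
open import Data.List.Membership.Propositional.Properties
  using ( ∈-map⁺; ∈-map⁻; ∈-upTo⁺; ∈-upTo⁻; ∈-filter⁺; ∈-filter⁻; ∈-deduplicate⁺; ∈-deduplicate⁻
        ; ∈-cartesianProductWith⁺; ∈-cartesianProductWith⁻)
open import Data.List.Membership.Propositional.Properties.WithK using (unique∧set⇒bag)
open import Data.List.Relation.Binary.BagAndSetEquality using (∼bag⇒↭)
open import Data.List.Relation.Binary.Permutation.Propositional using (_↭_; ↭-refl; ↭-sym; ↭⇒↭ₛ)
open import Data.List.Relation.Binary.Permutation.Propositional.Properties
  using (∷↭∷ʳ; ↭-reverse; ↭-length; map⁺; filter-↭; All-resp-↭)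
open import Data.List.Relation.Binary.Permutation.Setoid.Properties using (foldr-commMonoid)
open import Data.Maybe using (Maybe; just)
import Data.Maybe.Properties as Maybe
open import Data.Product using (_×_; _,_; proj₁; proj₂; ∃; uncurry)
open import Function using (_∘_; mk⇔)
open import Level using (Level)
open import Relation.Nullary using (Dec; yes; no; does; ¬_)
open import Relation.Nullary.Negation using (contradiction)
open import Relation.Unary using (Pred; Decidable)
open import Relation.Binary.PropositionalEquality
  using (_≡_; refl; sym; trans; cong; cong₂; subst; setoid; module ≡-Reasoning)

private
  variable
    a b p q : Level
    A : Set a
    B : Set b

rot-∷ʳ : ∀ l y → rot (l ∷ʳ y) ≡ y ∷ l
rot-∷ʳ l y = begin
  rotRev (reverse (l ++ [ y ]))  ≡⟨ cong rotRev (reverse-++ l [ y ]) ⟩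
  y ∷ reverse (reverse l)        ≡⟨ cong (y ∷_) (reverse-involutive l) ⟩
  y ∷ l                          ∎
  where open ≡-Reasoning

rot-++-∷ʳ : ∀ xs zs y → rot (xs ++ zs ∷ʳ y) ≡ y ∷ xs ++ zs
rot-++-∷ʳ xs zs y = trans (cong rot (sym (++-assoc xs zs [ y ]))) (rot-∷ʳ (xs ++ zs) y)

rotN-suc : ∀ k w → rotN (suc k) w ≡ rotN k (rot w)
rotN-suc zero    w = refl
rotN-suc (suc k) w = cong rot (rotN-suc k w)

length-∷ʳ : ∀ (l : Word) y → length (l ∷ʳ y) ≡ suc (length l)
length-∷ʳ l y = trans (length-++ l) (+-comm (length l) 1)

rotN-++ : ∀ xs {ys} → Reverse ys → rotN (length ys) (xs ++ ys) ≡ ys ++ xs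
rotN-++ xs []               = ++-identityʳ xs
rotN-++ xs (zs ∶ rs ∶ʳ y) = begin
  rotN (length (zs ∷ʳ y)) (xs ++ zs ∷ʳ y)     ≡⟨ cong (λ k → rotN k (xs ++ zs ∷ʳ y)) (length-∷ʳ zs y) ⟩
  rotN (suc (length zs)) (xs ++ zs ∷ʳ y)      ≡⟨ rotN-suc (length zs) _ ⟩
  rotN (length zs) (rot (xs ++ zs ∷ʳ y))      ≡⟨ cong (rotN (length zs)) (rot-++-∷ʳ xs zs y) ⟩
  rotN (length zs) ((y ∷ xs) ++ zs)           ≡⟨ rotN-++ (y ∷ xs) rs ⟩
  zs ++ y ∷ xs                                ≡⟨ sym (++-assoc zs [ y ] xs) ⟩
  zs ∷ʳ y ++ xs                               ∎
  where open ≡-Reasoning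

rotN-length : ∀ w → rotN (length w) w ≡ w
rotN-length w = trans (rotN-++ [] (reverseView w)) (++-identityʳ w)

rot-injective : ∀ {v w} → rot v ≡ rot w → v ≡ w
rot-injective {v} {w} eq = reverse-injective (rotRev-injective (reverse v) (reverse w) eq)
  where
  rotRev-injective : ∀ r s → rotRev r ≡ rotRev s → r ≡ s
  rotRev-injective []      []      _  = refl
  rotRev-injective (x ∷ r) (y ∷ s) eq with refl , eq′ ← ∷-injective eq = cong (x ∷_) (reverse-injective eq′)

rot-↭ : ∀ w → w ↭ rot w
rot-↭ w with initLast w
... | []      = ↭-refl
... | l ∷ʳ′ y = subst (l ∷ʳ y ↭_) (sym (rot-∷ʳ l y)) (↭-sym (∷↭∷ʳ y l))

last-∷ʳ : ∀ (l : Word) y → last (l ∷ʳ y) ≡ just y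
last-∷ʳ []           y = refl
last-∷ʳ (x ∷ [])     y = refl
last-∷ʳ (x ∷ z ∷ l)  y = last-∷ʳ (z ∷ l) y

applyUpTo-cong : ∀ {f g : ℕ → A} → (∀ k → f k ≡ g k) → ∀ n → applyUpTo f n ≡ applyUpTo g n
applyUpTo-cong {f = f} {g} f≗g n = trans (sym (map-upTo f n)) (trans (map-cong f≗g (upTo n)) (map-upTo g n))

-- The last letters of w, rot w, …, rot^(n-1) w are the letters of w read backwards
-- (stated for w = xs ++ ys and the first |ys| rotations, so that induction on ys goes through).
lastLetters-rotN : ∀ xs {ys} → Reverse ys
  → applyUpTo (λ k → last (rotN k (xs ++ ys))) (length ys) ≡ map just (reverse ys)
lastLetters-rotN xs []               = refl
lastLetters-rotN xs (zs ∶ rs ∶ʳ y) = begin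
  applyUpTo (λ k → last (rotN k (xs ++ zs ∷ʳ y))) (length (zs ∷ʳ y))
    ≡⟨ cong (applyUpTo (λ k → last (rotN k (xs ++ zs ∷ʳ y)))) (length-∷ʳ zs y) ⟩
  last (xs ++ zs ∷ʳ y) ∷ applyUpTo (λ k → last (rotN (suc k) (xs ++ zs ∷ʳ y))) (length zs)
    ≡⟨ cong₂ _∷_ last-letter (applyUpTo-cong shifted (length zs)) ⟩
  just y ∷ applyUpTo (λ k → last (rotN k ((y ∷ xs) ++ zs))) (length zs)
    ≡⟨ cong (just y ∷_) (lastLetters-rotN (y ∷ xs) rs) ⟩
  just y ∷ map just (reverse zs)
    ≡⟨ cong (map just) (sym (reverse-++ zs [ y ])) ⟩
  map just (reverse (zs ∷ʳ y)) ∎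
  where
  open ≡-Reasoning
  last-letter : last (xs ++ zs ∷ʳ y) ≡ just y
  last-letter = trans (cong last (sym (++-assoc xs zs [ y ]))) (last-∷ʳ (xs ++ zs) y)
  shifted : ∀ k → last (rotN (suc k) (xs ++ zs ∷ʳ y)) ≡ last (rotN k ((y ∷ xs) ++ zs))
  shifted k = cong last (trans (rotN-suc k _) (cong (rotN k) (rot-++-∷ʳ xs zs y)))

Cyclic : {B : Set} → (Word → B) → Set
Cyclic f = ∀ y l → f (y ∷ l) ≡ f (l ∷ʳ y)

cyclic⇒rot-invariant : ∀ {B : Set} (f : Word → B) → Cyclic f → ∀ w → f (rot w) ≡ f w
cyclic⇒rot-invariant f cyc w with initLast w
... | []      = refl
... | l ∷ʳ′ y = trans (cong f (rot-∷ʳ l y)) (cyc y l)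

count-↭ : ∀ j {xs ys} → xs ↭ ys → count j xs ≡ count j ys
count-↭ j p = ↭-length (filter-↭ (j ≟_) p)

maxLetter-↭ : ∀ {xs ys} → xs ↭ ys → maxLetter xs ≡ maxLetter ys
maxLetter-↭ {xs} {ys} p = begin
  maxLetter xs         ≡⟨ maxLetter-foldr xs ⟩
  foldr _⊔_ 0 xs       ≡⟨ foldr-commMonoid (setoid ℕ) ⊔-0.isCommutativeMonoid (↭⇒↭ₛ p) ⟩
  foldr _⊔_ 0 ys       ≡⟨ sym (maxLetter-foldr ys) ⟩
  maxLetter ys         ∎
  where
  open ≡-Reasoning
  module ⊔-0 = CommutativeMonoid ⊔-0-commutativeMonoid
  maxLetter-foldr : ∀ w → maxLetter w ≡ foldr _⊔_ 0 w
  maxLetter-foldr []      = refl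
  maxLetter-foldr (x ∷ w) = cong (x ⊔_) (maxLetter-foldr w)

content-↭ : ∀ {xs ys} → xs ↭ ys → content xs ≡ content ys
content-↭ {xs} p = trans (cong (λ m → map (λ j → count j xs) (oneTo m)) (maxLetter-↭ p))
                         (map-cong (λ j → count-↭ j p) _)

-- cdes counts the descents among the cyclic adjacent pairs zip w (shiftL w).
-- Moving the first letter to the end moves the first pair to the end of this list.
zip-∷ʳ : ∀ {as : List A} {bs : List B} x y → length as ≡ length bs
  → zip (as ∷ʳ x) (bs ∷ʳ y) ≡ zip as bs ∷ʳ (x , y)
zip-∷ʳ {as = []}     {[]}     x y _  = refl
zip-∷ʳ {as = a ∷ as} {b ∷ bs} x y eq = cong ((a , b) ∷_) (zip-∷ʳ x y (suc-injective eq))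

cdes-cyclic : Cyclic cdes
cdes-cyclic y []      = refl
cdes-cyclic y (z ∷ l) = begin
  count↓ ((y , z) ∷ zip (z ∷ l) (l ∷ʳ y))
    ≡⟨ ↭-length (filter-↭ descent? (∷↭∷ʳ (y , z) _)) ⟩
  count↓ (zip (z ∷ l) (l ∷ʳ y) ∷ʳ (y , z))
    ≡⟨ cong count↓ (zip-∷ʳ {as = z ∷ l} {bs = l ∷ʳ y} y z (sym (length-∷ʳ l y))) ⟨
  count↓ (zip ((z ∷ l) ∷ʳ y) ((l ∷ʳ y) ∷ʳ z))
    ∎
  where
  open ≡-Reasoning
  descent? : Decidable {A = ℕ × ℕ} (λ p → proj₂ p < proj₁ p)
  descent? p = proj₂ p <? proj₁ p
  count↓ : List (ℕ × ℕ) → ℕ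
  count↓ = length ∘ filter descent?

-- Moving a letter y to the end either moves it in w^(i) too (y ≤ i) or leaves w^(i) alone.
restricted-cdes-cyclic : ∀ i → Cyclic (cdes ∘ restrict i)
restricted-cdes-cyclic i y l with y ≤? i
... | yes y≤i = begin
  cdes (restrict i (y ∷ l))                    ≡⟨ cong cdes (filter-accept (_≤? i) y≤i) ⟩
  cdes (y ∷ restrict i l)                      ≡⟨ cdes-cyclic y (restrict i l) ⟩
  cdes (restrict i l ++ y ∷ [])                ≡⟨ cong (cdes ∘ (restrict i l ++_)) (filter-accept (_≤? i) y≤i) ⟨
  cdes (restrict i l ++ restrict i [ y ])      ≡⟨ cong cdes (sym (filter-++ (_≤? i) l [ y ])) ⟩
  cdes (restrict i (l ∷ʳ y))                   ∎
  where open ≡-Reasoning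
... | no y≰i = begin
  cdes (restrict i (y ∷ l))                    ≡⟨ cong cdes (filter-reject (_≤? i) y≰i) ⟩
  cdes (restrict i l)                          ≡⟨ cong cdes (sym (++-identityʳ (restrict i l))) ⟩
  cdes (restrict i l ++ [])                    ≡⟨ cong (cdes ∘ (restrict i l ++_)) (filter-reject (_≤? i) y≰i) ⟨
  cdes (restrict i l ++ restrict i [ y ])      ≡⟨ cong cdes (sym (filter-++ (_≤? i) l [ y ])) ⟩
  cdes (restrict i (l ∷ʳ y))                   ∎
  where open ≡-Reasoning

CDT-rot : ∀ m w → CDT m (rot w) ≡ CDT m w
CDT-rot m w = map-cong diff-rot (oneTo m)
  where
  restricted-rot : ∀ i → cdes (restrict i (rot w)) ≡ cdes (restrict i w)
  restricted-rot i = cyclic⇒rot-invariant (cdes ∘ restrict i) (restricted-cdes-cyclic i) w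
  diff-rot : ∀ j → cdesDiff (rot w) j ≡ cdesDiff w j
  diff-rot zero    = refl
  diff-rot (suc j) = cong₂ (λ a b → ℤ.+ a ℤ.- ℤ.+ b) (restricted-rot (suc j)) (restricted-rot j)

InW-rot : ∀ α δ {w} → InW α δ w → InW α δ (rot w)
InW-rot α δ {w} (positive , cont , cdt) =
  All-resp-↭ (rot-↭ w) positive , trans (sym (content-↭ (rot-↭ w))) cont , trans (CDT-rot (length α) w) cdt

sum-cong-∈ : ∀ {f g : A → ℕ} xs → (∀ {x} → x ∈ xs → f x ≡ g x) → sum (map f xs) ≡ sum (map g xs)
sum-cong-∈ xs f≗g = cong sum (map-cong-local (All.tabulate f≗g))

sum-const : ∀ c (xs : List A) → sum (map (λ _ → c) xs) ≡ length xs * c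
sum-const c []       = refl
sum-const c (x ∷ xs) = cong (c +_) (sum-const c xs)

sum-+ : ∀ (f g : A → ℕ) xs → sum (map (λ x → f x + g x) xs) ≡ sum (map f xs) + sum (map g xs)
sum-+ f g []       = refl
sum-+ f g (x ∷ xs) = trans (cong (f x + g x +_) (sum-+ f g xs)) (interchange (f x) (g x) _ _)

sum-swap : ∀ (f : A → B → ℕ) xs ys
  → sum (map (λ x → sum (map (f x) ys)) xs) ≡ sum (map (λ y → sum (map (λ x → f x y) xs)) ys)
sum-swap f []       ys = sym (trans (sum-const 0 ys) (*-zeroʳ (length ys)))
sum-swap f (x ∷ xs) ys = trans (cong (sum (map (f x) ys) +_) (sum-swap f xs ys))
                               (sym (sum-+ (f x) (λ y → sum (map (λ x′ → f x′ y) xs)) ys))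

𝟙 : ∀ {P : Set p} → Dec P → ℕ
𝟙 d = if does d then 1 else 0

𝟙-cong : ∀ {P : Set p} {Q : Set q} → (P → Q) → (Q → P) → (d : Dec P) (e : Dec Q) → 𝟙 d ≡ 𝟙 e
𝟙-cong P⇒Q Q⇒P (yes _)  (yes _)  = refl
𝟙-cong P⇒Q Q⇒P (yes p)  (no ¬q)  = contradiction (P⇒Q p) ¬q
𝟙-cong P⇒Q Q⇒P (no ¬p)  (yes q)  = contradiction (Q⇒P q) ¬p
𝟙-cong P⇒Q Q⇒P (no _)   (no _)   = refl

𝟙-yes : ∀ {P : Set p} → P → (d : Dec P) → 𝟙 d ≡ 1
𝟙-yes p (yes _) = refl
𝟙-yes p (no ¬p) = contradiction p ¬p

𝟙-no : ∀ {P : Set p} → ¬ P → (d : Dec P) → 𝟙 d ≡ 0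
𝟙-no ¬p (yes p) = contradiction p ¬p
𝟙-no ¬p (no _)  = refl

length-filter : ∀ {P : Pred A p} (P? : Decidable P) xs → length (filter P? xs) ≡ sum (map (𝟙 ∘ P?) xs)
length-filter P? []       = refl
length-filter P? (x ∷ xs) with does (P? x)
... | true  = cong suc (length-filter P? xs)
... | false = length-filter P? xs

length-filter-cong : ∀ {P : Pred A p} {Q : Pred A q} (P? : Decidable P) (Q? : Decidable Q) xs
  → (∀ {x} → x ∈ xs → P x → Q x) → (∀ {x} → x ∈ xs → Q x → P x)
  → length (filter P? xs) ≡ length (filter Q? xs)
length-filter-cong P? Q? xs P⇒Q Q⇒P = begin
  length (filter P? xs)    ≡⟨ length-filter P? xs ⟩
  sum (map (𝟙 ∘ P?) xs)    ≡⟨ sum-cong-∈ xs (λ x∈xs → 𝟙-cong (P⇒Q x∈xs) (Q⇒P x∈xs) (P? _) (Q? _)) ⟩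
  sum (map (𝟙 ∘ Q?) xs)    ≡⟨ length-filter Q? xs ⟨
  length (filter Q? xs)    ∎
  where open ≡-Reasoning

length-filter-filter : ∀ {P : Pred A p} {Q : Pred A q} (P? : Decidable P) (Q? : Decidable Q)
  → (∀ {x} → Q x → P x) → ∀ xs → length (filter Q? (filter P? xs)) ≡ length (filter Q? xs)
length-filter-filter P? Q? Q⇒P []       = refl
length-filter-filter P? Q? Q⇒P (x ∷ xs) with P? x
... | yes _ with Q? x
...   | yes _ = cong suc (length-filter-filter P? Q? Q⇒P xs)
...   | no  _ = length-filter-filter P? Q? Q⇒P xs
length-filter-filter P? Q? Q⇒P (x ∷ xs) | no ¬p with Q? x
...   | yes q = contradiction (Q⇒P q) ¬p
...   | no  _ = length-filter-filter P? Q? Q⇒P xs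

RotClosed : List Word → Set
RotClosed S = ∀ {u} → u ∈ S → rot u ∈ S

rotN-∈ : ∀ {S u} → RotClosed S → ∀ k → u ∈ S → rotN k u ∈ S
rotN-∈ closed zero    u∈S = u∈S
rotN-∈ closed (suc k) u∈S = closed (rotN-∈ closed k u∈S)

rotN-preserves : ∀ {P : Pred Word p} → (∀ {u} → P u → P (rot u)) → ∀ k {w} → P w → P (rotN k w)
rotN-preserves         P-rot zero    Pw = Pw
rotN-preserves {P = P} P-rot (suc k) Pw = P-rot (rotN-preserves {P = P} P-rot k Pw)

-- Each member u of a rotation-closed list is the rotation of a member, namely rot^(n-1) u.
rot-onto : ∀ {S u} → RotClosed S → u ∈ S → u ∈ map rot S
rot-onto {u = []}     closed u∈S = ∈-map⁺ rot u∈S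
rot-onto {u = x ∷ xs} closed u∈S =
  subst (_∈ map _ _) (rotN-length (x ∷ xs)) (∈-map⁺ rot (rotN-∈ closed (length xs) u∈S))

map-rot-↭ : ∀ {S} → Unique S → RotClosed S → map rot S ↭ S
map-rot-↭ {S} unique closed =
  ∼bag⇒↭ (unique∧set⇒bag (Unique.map⁺ rot-injective unique) unique (mk⇔ into (rot-onto closed)))
  where
  into : ∀ {u} → u ∈ map rot S → u ∈ S
  into u∈rotS with v , v∈S , refl ← ∈-map⁻ rot u∈rotS = closed v∈S

sum-rotN : ∀ {S} → Unique S → RotClosed S → ∀ (f : Word → ℕ) k → sum (map (f ∘ rotN k) S) ≡ sum (map f S)
sum-rotN         unique closed f zero    = refl
sum-rotN {S = S} unique closed f (suc k) = begin
  sum (map (f ∘ rot ∘ rotN k) S)   ≡⟨ sum-rotN unique closed (f ∘ rot) k ⟩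
  sum (map (f ∘ rot) S)            ≡⟨ cong sum (map-∘ S) ⟩
  sum (map f (map rot S))          ≡⟨ sum-↭ (map⁺ f (map-rot-↭ unique closed)) ⟩
  sum (map f S)                    ∎
  where open ≡-Reasoning

filter-rotClosed : ∀ {P : Pred Word p} (P? : Decidable P) {S}
  → (∀ {u} → P u → P (rot u)) → RotClosed S → RotClosed (filter P? S)
filter-rotClosed P? P-rot closed u∈ with u∈S , Pu ← ∈-filter⁻ P? u∈ = ∈-filter⁺ P? (closed u∈S) (P-rot Pu)

endsWith? : ∀ j (u : Word) → Dec (last u ≡ just j)
endsWith? j u = Maybe.≡-dec _≟_ (last u) (just j)

count-by-rotations : ∀ j u → count j u ≡ sum (map (λ k → 𝟙 (endsWith? j (rotN k u))) (upTo (length u)))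
count-by-rotations j u = begin
  count j u                                                     ≡⟨ count-↭ j (↭-sym (↭-reverse u)) ⟩
  count j (reverse u)                                           ≡⟨ length-filter (j ≟_) (reverse u) ⟩
  sum (map (𝟙 ∘ (j ≟_)) (reverse u))                           ≡⟨ cong sum (map-cong just-test (reverse u)) ⟩
  sum (map (is-j ∘ just) (reverse u))                           ≡⟨ cong sum (map-∘ (reverse u)) ⟩
  sum (map is-j (map just (reverse u)))                         ≡⟨ cong (sum ∘ map is-j) (lastLetters-rotN [] (reverseView u)) ⟨
  sum (map is-j (applyUpTo (λ k → last (rotN k u)) (length u))) ≡⟨ cong (sum ∘ map is-j) (map-upTo _ (length u)) ⟨
  sum (map is-j (map (λ k → last (rotN k u)) (upTo (length u)))) ≡⟨ cong sum (map-∘ (upTo (length u))) ⟨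
  sum (map (λ k → 𝟙 (endsWith? j (rotN k u))) (upTo (length u))) ∎
  where
  open ≡-Reasoning
  is-j : Maybe ℕ → ℕ
  is-j m = 𝟙 (Maybe.≡-dec _≟_ m (just j))
  just-test : ∀ x → 𝟙 (j ≟ x) ≡ is-j (just x)
  just-test x = 𝟙-cong (cong just ∘ sym) (sym ∘ Maybe.just-injective) (j ≟ x) (Maybe.≡-dec _≟_ (just x) (just j))

-- Cyclic counting: in a duplicate-free rotation-closed list S of words of length n,
-- the total number of letters j equals n times the number of words ending with j.
-- (Count the pairs (u , k) with rot^k u ending in j, first by u, then by k.)
cyclic-count : ∀ {S} n j → Unique S → RotClosed S → (∀ {u} → u ∈ S → length u ≡ n)
  → sum (map (count j) S) ≡ n * length (filter (endsWith? j) S)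
cyclic-count {S} n j unique closed length≡n = begin
  sum (map (count j) S)                                   ≡⟨ sum-cong-∈ S by-rotations ⟩
  sum (map (λ u → sum (map (λ k → ends (rotN k u)) (upTo n))) S)
                                                          ≡⟨ sum-swap (λ u k → ends (rotN k u)) S (upTo n) ⟩
  sum (map (λ k → sum (map (ends ∘ rotN k) S)) (upTo n))  ≡⟨ cong sum (map-cong (sum-rotN unique closed ends) (upTo n)) ⟩
  sum (map (λ _ → sum (map ends S)) (upTo n))             ≡⟨ sum-const _ (upTo n) ⟩
  length (upTo n) * sum (map ends S)                      ≡⟨ cong₂ _*_ (length-upTo n) (sym (length-filter (endsWith? j) S)) ⟩
  n * length (filter (endsWith? j) S)                     ∎
  where
  open ≡-Reasoning
  ends : Word → ℕ
  ends = 𝟙 ∘ endsWith? j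
  by-rotations : ∀ {u} → u ∈ S → count j u ≡ sum (map (λ k → ends (rotN k u)) (upTo n))
  by-rotations {u} u∈S = subst (λ m → count j u ≡ sum (map (λ k → ends (rotN k u)) (upTo m)))
                               (length≡n u∈S) (count-by-rotations j u)

occurs-once : ∀ x {J} → Unique J → x ∈ J → sum (map (λ j → 𝟙 (j ≟ x)) J) ≡ 1
occurs-once x {_ ∷ J} (x∉J ∷ _) (here refl) = cong₂ _+_ (𝟙-yes refl (x ≟ x)) absent
  where
  absent : sum (map (λ j → 𝟙 (j ≟ x)) J) ≡ 0
  absent = trans (sym (length-filter (_≟ x) J))
                 (cong length (filter-none (_≟ x) (All.map (λ x≢j j≡x → x≢j (sym j≡x)) x∉J)))
occurs-once x {j ∷ J} (j∉J ∷ unique) (there x∈J) =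
  cong₂ _+_ (𝟙-no (All.lookup j∉J x∈J) (j ≟ x)) (occurs-once x unique x∈J)

oneTo-unique : ∀ m → Unique (oneTo m)
oneTo-unique m = Unique.map⁺ suc-injective (Unique.upTo⁺ m)

∈-oneTo : ∀ {x m} → 1 ≤ x → x ≤ m → x ∈ oneTo m
∈-oneTo {suc x} (s≤s _) x<m = ∈-map⁺ suc (∈-upTo⁺ x<m)

letters-≤-max : ∀ w → All (_≤ maxLetter w) w
letters-≤-max []      = []
letters-≤-max (x ∷ w) =
  m≤m⊔n x (maxLetter w) ∷ All.map (λ y≤max → ≤-trans y≤max (m≤n⊔m x (maxLetter w))) (letters-≤-max w)

letters-∈-oneTo : ∀ w → Positive w → All (_∈ oneTo (maxLetter w)) w
letters-∈-oneTo w positive = All.zipWith (uncurry ∈-oneTo) (positive , letters-≤-max w)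

sum-content : ∀ w → Positive w → sum (content w) ≡ length w
sum-content w positive = begin
  sum (map (λ j → count j w) J)                             ≡⟨ cong sum (map-cong (λ j → length-filter (j ≟_) w) J) ⟩
  sum (map (λ j → sum (map (λ x → 𝟙 (j ≟ x)) w)) J)          ≡⟨ sum-swap (λ j x → 𝟙 (j ≟ x)) J w ⟩
  sum (map (λ x → sum (map (λ j → 𝟙 (j ≟ x)) J)) w)          ≡⟨ sum-cong-∈ w once ⟩
  sum (map (λ _ → 1) w)                                     ≡⟨ sum-const 1 w ⟩
  length w * 1                                              ≡⟨ *-identityʳ (length w) ⟩
  length w                                                  ∎
  where
  open ≡-Reasoning
  J : List ℕ
  J = oneTo (maxLetter w)
  once : ∀ {x} → x ∈ w → sum (map (λ j → 𝟙 (j ≟ x)) J) ≡ 1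
  once x∈w = occurs-once _ (oneTo-unique (maxLetter w)) (All.lookup (letters-∈-oneTo w positive) x∈w)

count-1-head : ∀ u {a as} → content u ≡ a ∷ as → count 1 u ≡ a
count-1-head u = first (maxLetter u)
  where
  first : ∀ m {a as} → map (λ j → count j u) (oneTo m) ≡ a ∷ as → count 1 u ≡ a
  first (suc m) eq = ∷-injectiveˡ eq

wordsOver-suc : ∀ k m → wordsOver (suc k) m ≡ cartesianProductWith _∷_ (oneTo m) (wordsOver k m)
wordsOver-suc k m = prefixed (oneTo m)
  where
  prefixed : ∀ hs → concatMap (λ h → map (h ∷_) (wordsOver k m)) hs ≡ cartesianProductWith _∷_ hs (wordsOver k m)
  prefixed []       = refl
  prefixed (h ∷ hs) = cong (map (h ∷_) (wordsOver k m) ++_) (prefixed hs)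

wordsOver-unique : ∀ k m → Unique (wordsOver k m)
wordsOver-unique zero    m = [] ∷ []
wordsOver-unique (suc k) m = subst Unique (sym (wordsOver-suc k m))
  (Unique.cartesianProductWith⁺ _∷_ ∷-injective (oneTo-unique m) (wordsOver-unique k m))

∈-wordsOver⁻ : ∀ k m {u} → u ∈ wordsOver k m → length u ≡ k × All (_∈ oneTo m) u
∈-wordsOver⁻ zero    m (here refl) = refl , []
∈-wordsOver⁻ (suc k) m u∈
  with h , t , h∈ , t∈ , refl ← ∈-cartesianProductWith⁻ _∷_ (oneTo m) (wordsOver k m)
                                   (subst (_ ∈_) (wordsOver-suc k m) u∈)
  with length≡k , letters ← ∈-wordsOver⁻ k m t∈
  = cong suc length≡k , h∈ ∷ letters

∈-wordsOver⁺ : ∀ k m {u} → length u ≡ k → All (_∈ oneTo m) u → u ∈ wordsOver k m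
∈-wordsOver⁺ zero    m {[]}    refl []             = here refl
∈-wordsOver⁺ (suc k) m {h ∷ t} length≡k (h∈ ∷ letters) = subst (h ∷ t ∈_) (sym (wordsOver-suc k m))
  (∈-cartesianProductWith⁺ _∷_ h∈ (∈-wordsOver⁺ k m (suc-injective length≡k) letters))

-- Length and alphabet are preserved by rotation, so wordsOver k m is rotation-closed.
wordsOver-rotClosed : ∀ k m → RotClosed (wordsOver k m)
wordsOver-rotClosed k m {u} u∈ with length≡k , letters ← ∈-wordsOver⁻ k m u∈ =
  ∈-wordsOver⁺ k m (trans (sym (↭-length (rot-↭ u))) length≡k) (All-resp-↭ (rot-↭ u) letters)

∈-necklace⁻ : ∀ w {u} → u ∈ necklace w → ∃ λ k → k < length w × u ≡ rotN k w
∈-necklace⁻ w u∈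
  with k , k∈ , refl ← ∈-map⁻ (λ k → rotN k w) (∈-deduplicate⁻ (≡-dec _≟_) _ u∈) = k , ∈-upTo⁻ k∈ , refl

∈-necklace⁺ : ∀ w {k} → k < length w → rotN k w ∈ necklace w
∈-necklace⁺ w k<n = ∈-deduplicate⁺ (≡-dec _≟_) (∈-map⁺ (λ k → rotN k w) (∈-upTo⁺ k<n))

necklace-unique : ∀ w → Unique (necklace w)
necklace-unique w = DecUnique.deduplicate-! (≡-dec _≟_) _

-- Rotating rot^k w gives rot^(k+1) w, which is w again when k + 1 = n.
necklace-rotClosed : ∀ w → RotClosed (necklace w)
necklace-rotClosed w u∈ with k , k<n , refl ← ∈-necklace⁻ w u∈ with suc k <? length w
... | yes k+1<n = ∈-necklace⁺ w k+1<n
... | no  k+1≮n = subst (_∈ necklace w) (sym full-turn) (∈-necklace⁺ w {0} (≤-trans (s≤s z≤n) k<n))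
  where
  full-turn : rotN (suc k) w ≡ w
  full-turn = trans (cong (λ j → rotN j w) (≤-antisym k<n (≮⇒≥ k+1≮n))) (rotN-length w)

-- Every word has a₁ ones and length n, so this is cyclic counting
-- with j = 1, and within 𝒲_{α,δ} a word is in 𝒲̃_{α,δ} exactly when it ends with 1.
rotation-closed-count : ∀ a₁ α′ δ {S} → Unique S → RotClosed S → (∀ {u} → u ∈ S → InW (a₁ ∷ α′) δ u)
  → a₁ * length S ≡ sum (a₁ ∷ α′) * length (filter (inW~? (a₁ ∷ α′) δ) S)
rotation-closed-count a₁ α′ δ {S} unique closed inW = begin
  a₁ * length S                         ≡⟨ *-comm a₁ (length S) ⟩
  length S * a₁                         ≡⟨ sum-const a₁ S ⟨
  sum (map (λ _ → a₁) S)                ≡⟨ sum-cong-∈ S ones ⟨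
  sum (map (count 1) S)                 ≡⟨ cyclic-count n 1 unique closed length≡n ⟩
  n * length (filter (endsWith? 1) S)   ≡⟨ cong (n *_) (length-filter-cong (endsWith? 1) (inW~? α δ) S ends→W̃ W̃→ends) ⟩
  n * length (filter (inW~? α δ) S)     ∎
  where
  open ≡-Reasoning
  α : List ℕ
  α = a₁ ∷ α′
  n : ℕ
  n = sum α
  ones : ∀ {u} → u ∈ S → count 1 u ≡ a₁
  ones {u} u∈S = count-1-head u (proj₁ (proj₂ (inW u∈S)))
  ends→W̃ : ∀ {u} → u ∈ S → last u ≡ just 1 → InW~ α δ u
  ends→W̃ u∈S ends = inW u∈S , ends
  W̃→ends : ∀ {u} → u ∈ S → InW~ α δ u → last u ≡ just 1
  W̃→ends _ = proj₂
  length≡n : ∀ {u} → u ∈ S → length u ≡ n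
  length≡n u∈S with positive , content≡α , _ ← inW u∈S = trans (sym (sum-content _ positive)) (cong sum content≡α)

lemma5p15 : (n a₁ : ℕ) (α' δ' : List ℕ)
    → 1 ≤ n
    → All (1 ≤_) (a₁ ∷ α')
    → sum (a₁ ∷ α') ≡ n
    → length δ' ≡ length α'
    → ((w : Word) → InW (a₁ ∷ α') (0 ∷ δ') w
         → a₁ * length (necklace w)
           ≡ n * length (filter (inW~? (a₁ ∷ α') (0 ∷ δ')) (necklace w)))
      × (a₁ * cardW (a₁ ∷ α') (0 ∷ δ') ≡ n * cardW~ (a₁ ∷ α') (0 ∷ δ'))
lemma5p15 .(sum (a₁ ∷ α')) a₁ α' δ' _ _ refl _ = necklace-count , class-count
  where
  α δ : List ℕ
  α = a₁ ∷ α'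
  δ = 0 ∷ δ'

  necklace-count : (w : Word) → InW α δ w → a₁ * length (necklace w) ≡ sum α * length (filter (inW~? α δ) (necklace w))
  necklace-count w w∈𝒲 = rotation-closed-count a₁ α' δ (necklace-unique w) (necklace-rotClosed w) in-class
    where
    in-class : ∀ {u} → u ∈ necklace w → InW α δ u
    in-class u∈ with k , _ , refl ← ∈-necklace⁻ w u∈ = rotN-preserves {P = InW α δ} (InW-rot α δ) k w∈𝒲

  W : List Word
  W = wordsOver (sum α) (length α)

  class-count : a₁ * cardW α δ ≡ sum α * cardW~ α δ
  class-count = begin
    a₁ * length (filter (inW? α δ) W)
      ≡⟨ rotation-closed-count a₁ α' δ unique closed in-class ⟩
    sum α * length (filter (inW~? α δ) (filter (inW? α δ) W))
      ≡⟨ cong (sum α *_) (length-filter-filter (inW? α δ) (inW~? α δ) proj₁ W) ⟩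
    sum α * length (filter (inW~? α δ) W)
      ∎
    where
    open ≡-Reasoning
    unique : Unique (filter (inW? α δ) W)
    unique = Unique.filter⁺ (inW? α δ) (wordsOver-unique (sum α) (length α))
    closed : RotClosed (filter (inW? α δ) W)
    closed = filter-rotClosed (inW? α δ) (InW-rot α δ) (wordsOver-rotClosed (sum α) (length α))
    in-class : ∀ {u} → u ∈ filter (inW? α δ) W → InW α δ u
    in-class = proj₂ ∘ ∈-filter⁻ (inW? α δ) {xs = W}
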